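{- Let $a\ge0$ and $b\ge1$ be integers. Then for all positive integers $t$, $$i((1,1,a,b),t)+i((1,1,b-1,a+1),t)=(t+2)F(a+1,b,0,t).$$
   Context: For integers $a,b,t\ge0$ and $c\in\mathbb Z$, $F(a,b,c,t)=\sum_{j=0}^{a+b}(-1)^j\binom{a+b}{j}\binom{(t+1)(b-j)+a+c-1}{a+b-1}$, with $\binom00=1$ and $\binom NK=0$ whenever $K<0$ or $N<K$. For nonnegative integers $p,q,r,s$, $i((p,q,r,s),t)$ denotes $\sum_{j=0}^{t\min\{p,s\}}F(p,q,j,t)F(r,s,-j,t)$; when $q,r,s>0$ this is the Ehrhart polynomial (number of lattice points in the $t$-th dilate of the matroid polytope) of the Schubert matroid $\mathrm{SM}_n(S)$, $n=p+q+r+s$, where $S\subseteq[n]$ has indicator vector $(0^p,1^q,0^r,1^s)$ and the bases of $\mathrm{SM}_n(S)$ are the $T\subseteq[n]$, $|T|=|S|$, whose $i$-th smallest element is at most that of $S$ for all $i$. -}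

module Defs where

open import Data.Nat as ℕ using (ℕ; zero; suc; _⊓_)
open import Data.Nat.Combinatorics using (_C_)
open import Data.Integer as ℤ using (ℤ; +_; -[1+_]; _-_)
open import Data.Bool using (if_then_else_)
open import Relation.Nullary.Decidable using (⌊_⌋)

sumTo : ℕ → (ℕ → ℤ) → ℤ
sumTo zero    f = f zero
sumTo (suc m) f = sumTo m f ℤ.+ f (suc m)

binom : ℤ → ℤ → ℤ
binom N -[1+ _ ] = + 0
binom -[1+ _ ] (+ K) = + 0
binom (+ N) (+ K) = if ⌊ K ℕ.≤? N ⌋ then + (N C K) else + 0

sgn : ℕ → ℤ
sgn zero = + 1
sgn (suc j) = ℤ.- sgn j

F : ℕ → ℕ → ℤ → ℕ → ℤ
F a b c t = sumTo (a ℕ.+ b) λ j →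
  sgn j ℤ.* binom (+ (a ℕ.+ b)) (+ j)
        ℤ.* binom ((+ (suc t)) ℤ.* (+ b - + j) ℤ.+ + a ℤ.+ c - + 1) (+ (a ℕ.+ b) - + 1)

iPoly : ℕ → ℕ → ℕ → ℕ → ℕ → ℤ
iPoly p q r s t = sumTo (t ℕ.* (p ⊓ s)) λ j → F p q (+ j) t ℤ.* F r s (ℤ.- (+ j)) t

-- Write N_k(m) for the coefficient of x^m in (1 + x + … + x^t)^(k+1). Expanding
-- ((1 - x^(t+1))/(1 - x))^(k+1) shows F(a,b,c,t) = N_k(tb + c) whenever a + b = k + 1.
-- The coefficients N_k are palindromic, N_k(m) = N_k(t(k+1) - m), and satisfy
-- N_(k+1)(m) = Σ_{i ≤ t} N_k(m - i). Moreover F(1,1,j,t) = t + 1 - j for j ≤ t, so with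
-- c_i = N_(a+b-1)(t(b-1) + i) the two Ehrhart sums become Σ_j (t+1-j) c_(t-j) and
-- Σ_j (t+1-j) c_j. Reversing the first, the weights add up to t + 2, and Σ_i c_i is
-- F(a+1,b,0,t) by the recurrence.
{-# OPTIONS --safe #-}
module Submission where

open import Defs
open import Data.Nat using (ℕ; suc; _≥_; _∸_)
open import Data.Integer using (+_; _+_; _*_)
open import Relation.Binary.PropositionalEquality using (_≡_)
open import Data.Nat as ℕ using (zero; _≤_; z≤n)
import Data.Nat.Properties as ℕ
open import Data.Nat.Combinatorics
  using (_C_; k>n⇒nCk≡0; nCk+nC[k+1]≡[n+1]C[k+1]; nC1≡n)
open import Data.Integer as ℤ using (ℤ; -[1+_]; _-_; -_)
import Data.Integer.Properties as ℤ
open import Data.Integer.Tactic.RingSolver using (solve-∀)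
open import Relation.Nullary.Decidable using (yes; no)
open import Relation.Binary.PropositionalEquality
  using (refl; sym; trans; cong; cong₂; module ≡-Reasoning)
open import Function using (_∘_)

pos-∸ : ∀ {m n} → n ≤ m → + (m ∸ n) ≡ + m - + n
pos-∸ {m} {n} n≤m = sym (trans (ℤ.m-n≡m⊖n m n) (ℤ.⊖-≥ n≤m))

sumTo-cong : ∀ n {f g : ℕ → ℤ} → (∀ i → i ≤ n → f i ≡ g i) → sumTo n f ≡ sumTo n g
sumTo-cong zero    f≗g = f≗g 0 z≤n
sumTo-cong (suc n) f≗g =
  cong₂ _+_ (sumTo-cong n (λ i i≤n → f≗g i (ℕ.m≤n⇒m≤1+n i≤n))) (f≗g (suc n) ℕ.≤-refl)

sumTo-distrib-+ : ∀ n (f g : ℕ → ℤ) → sumTo n (λ i → f i + g i) ≡ sumTo n f + sumTo n g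
sumTo-distrib-+ zero    f g = refl
sumTo-distrib-+ (suc n) f g rewrite sumTo-distrib-+ n f g =
  interchange (sumTo n f) (sumTo n g) (f (suc n)) (g (suc n))
  where
  interchange : ∀ a b c d → a + b + (c + d) ≡ a + c + (b + d)
  interchange = solve-∀

*-distribˡ-sumTo : ∀ n c (f : ℕ → ℤ) → sumTo n (λ i → c * f i) ≡ c * sumTo n f
*-distribˡ-sumTo zero    c f = refl
*-distribˡ-sumTo (suc n) c f rewrite *-distribˡ-sumTo n c f =
  sym (ℤ.*-distribˡ-+ c (sumTo n f) (f (suc n)))

sumTo-head : ∀ n (f : ℕ → ℤ) → sumTo (suc n) f ≡ f 0 + sumTo n (f ∘ suc)
sumTo-head zero    f = refl
sumTo-head (suc n) f rewrite sumTo-head n f = ℤ.+-assoc (f 0) _ _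

sumTo-reverse : ∀ n (f : ℕ → ℤ) → sumTo n f ≡ sumTo n (λ i → f (n ∸ i))
sumTo-reverse zero    f = refl
sumTo-reverse (suc n) f = begin
  sumTo n f + f (suc n)                     ≡⟨ cong (_+ f (suc n)) (sumTo-reverse n f) ⟩
  sumTo n (λ i → f (n ∸ i)) + f (suc n)     ≡⟨ ℤ.+-comm _ (f (suc n)) ⟩
  f (suc n) + sumTo n (λ i → f (n ∸ i))     ≡⟨ sumTo-head n (λ i → f (suc n ∸ i)) ⟨
  sumTo (suc n) (λ i → f (suc n ∸ i))       ∎
  where open ≡-Reasoning

sumTo-comm : ∀ n m (f : ℕ → ℕ → ℤ) →
  sumTo n (λ i → sumTo m (f i)) ≡ sumTo m (λ j → sumTo n (λ i → f i j))
sumTo-comm zero    m f = refl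
sumTo-comm (suc n) m f rewrite sumTo-comm n m f =
  sym (sumTo-distrib-+ m (λ j → sumTo n (λ i → f i j)) (f (suc n)))

sumTo-reflected-weights : ∀ t (f : ℕ → ℤ) →
  sumTo t (λ j → (+ suc t - + j) * f (t ∸ j)) + sumTo t (λ j → (+ suc t - + j) * f j)
    ≡ + (t ℕ.+ 2) * sumTo t f
sumTo-reflected-weights t f = begin
  sumTo t (λ j → w j * f (t ∸ j)) + sumTo t (λ j → w j * f j)
    ≡⟨ cong (_+ sumTo t (λ j → w j * f j)) reflect ⟩
  sumTo t (λ j → w (t ∸ j) * f j) + sumTo t (λ j → w j * f j)
    ≡⟨ sumTo-distrib-+ t (λ j → w (t ∸ j) * f j) (λ j → w j * f j) ⟨
  sumTo t (λ j → w (t ∸ j) * f j + w j * f j)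
    ≡⟨ sumTo-cong t (λ j j≤t → weights-add-up j≤t) ⟩
  sumTo t (λ j → + (t ℕ.+ 2) * f j)
    ≡⟨ *-distribˡ-sumTo t (+ (t ℕ.+ 2)) f ⟩
  + (t ℕ.+ 2) * sumTo t f ∎
  where
  open ≡-Reasoning
  w : ℕ → ℤ
  w j = + suc t - + j
  reflect : sumTo t (λ j → w j * f (t ∸ j)) ≡ sumTo t (λ j → w (t ∸ j) * f j)
  reflect = trans (sumTo-reverse t _)
    (sumTo-cong t (λ j j≤t → cong (λ i → w (t ∸ j) * f i) (ℕ.m∸[m∸n]≡n j≤t)))
  identity : ∀ t j x → (+ 1 + t - (t - j)) * x + (+ 1 + t - j) * x ≡ (t + + 2) * x
  identity = solve-∀
  weights-add-up : ∀ {j} → j ≤ t → w (t ∸ j) * f j + w j * f j ≡ + (t ℕ.+ 2) * f j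
  weights-add-up {j} j≤t =
    trans (cong (λ i → (+ suc t - i) * f j + w j * f j) (pos-∸ j≤t))
      (trans (identity (+ t) (+ j) (f j)) (cong (_* f j) (sym (ℤ.pos-+ t 2))))

binom-pos : ∀ n k → binom (+ n) (+ k) ≡ + (n C k)
binom-pos n k with k ℕ.≤? n
... | yes _   = refl
... | no  k≰n = cong +_ (sym (k>n⇒nCk≡0 (ℕ.≰⇒> k≰n)))

binom-pascal : ∀ N k → binom (N + + 1) (+ suc k) ≡ binom N (+ suc k) + binom N (+ k)
binom-pascal (+ n) k = begin
  binom (+ (n ℕ.+ 1)) (+ suc k)       ≡⟨ cong (λ m → binom (+ m) (+ suc k)) (ℕ.+-comm n 1) ⟩
  binom (+ suc n) (+ suc k)           ≡⟨ binom-pos (suc n) (suc k) ⟩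
  + (suc n C suc k)                   ≡⟨ cong +_ (nCk+nC[k+1]≡[n+1]C[k+1] n k) ⟨
  + (n C k ℕ.+ n C suc k)             ≡⟨ ℤ.pos-+ (n C k) _ ⟩
  + (n C k) + + (n C suc k)           ≡⟨ ℤ.+-comm (+ (n C k)) (+ (n C suc k)) ⟩
  + (n C suc k) + + (n C k)           ≡⟨ cong₂ _+_ (binom-pos n (suc k)) (binom-pos n k) ⟨
  binom (+ n) (+ suc k) + binom (+ n) (+ k) ∎
  where open ≡-Reasoning
binom-pascal -[1+ zero  ] k = refl
binom-pascal -[1+ suc n ] k = refl

-- binom x 0 is the indicator of x ≥ 0.
binom-0-complement : ∀ x → binom x (+ 0) + binom (- x - + 1) (+ 0) ≡ + 1
binom-0-complement (+ zero)  = refl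
binom-0-complement (+ suc n) = refl
binom-0-complement -[1+ n ]  = binom-pos n 0

-- Counts the ways to write x as a sum of k + 1 (not k) nonnegative integers.
weakCompositions : ℕ → ℤ → ℤ
weakCompositions k x = binom (x + + k) (+ k)

weakCompositions-pascal : ∀ k x →
  weakCompositions (suc k) x ≡ weakCompositions (suc k) (x - + 1) + weakCompositions k x
weakCompositions-pascal k x = begin
  binom (x + + suc k) (+ suc k)
    ≡⟨ cong (λ y → binom y (+ suc k)) (rearrange₁ x (+ k)) ⟩
  binom (x + + k + + 1) (+ suc k)
    ≡⟨ binom-pascal (x + + k) k ⟩
  binom (x + + k) (+ suc k) + binom (x + + k) (+ k)
    ≡⟨ cong (λ y → binom y (+ suc k) + binom (x + + k) (+ k)) (rearrange₂ x (+ k)) ⟩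
  binom (x - + 1 + + suc k) (+ suc k) + binom (x + + k) (+ k) ∎
  where
  open ≡-Reasoning
  rearrange₁ : ∀ x k → x + (+ 1 + k) ≡ x + k + + 1
  rearrange₁ = solve-∀
  rearrange₂ : ∀ x k → x + k ≡ x - + 1 + (+ 1 + k)
  rearrange₂ = solve-∀

weakCompositions-hockeyStick : ∀ k u x →
  sumTo u (λ i → weakCompositions k (x - + i))
    ≡ weakCompositions (suc k) x - weakCompositions (suc k) (x - + suc u)
weakCompositions-hockeyStick k zero x = begin
  W k (x + + 0)                       ≡⟨ cong (W k) (ℤ.+-identityʳ x) ⟩
  W k x                               ≡⟨ cancel (W k x) (W (suc k) (x - + 1)) ⟩
  W (suc k) (x - + 1) + W k x - W (suc k) (x - + 1)
                                      ≡⟨ cong (_- W (suc k) (x - + 1)) (weakCompositions-pascal k x) ⟨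
  W (suc k) x - W (suc k) (x - + 1)   ∎
  where
  open ≡-Reasoning
  W = weakCompositions
  cancel : ∀ a b → a ≡ b + a - b
  cancel = solve-∀
weakCompositions-hockeyStick k (suc u) x = begin
  sumTo u (λ i → W k (x - + i)) + W k y
    ≡⟨ cong (_+ W k y) (weakCompositions-hockeyStick k u x) ⟩
  W (suc k) x - W (suc k) y + W k y
    ≡⟨ cong (λ z → W (suc k) x - z + W k y) (weakCompositions-pascal k y) ⟩
  W (suc k) x - (W (suc k) (y - + 1) + W k y) + W k y
    ≡⟨ cancel (W (suc k) x) (W (suc k) (y - + 1)) (W k y) ⟩
  W (suc k) x - W (suc k) (y - + 1)
    ≡⟨ cong (λ z → W (suc k) x - W (suc k) z) (rearrange x (+ suc u)) ⟩
  W (suc k) x - W (suc k) (x - + suc (suc u)) ∎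
  where
  open ≡-Reasoning
  W = weakCompositions
  y = x - + suc u
  cancel : ∀ a b c → a - (b + c) + c ≡ a - b
  cancel = solve-∀
  rearrange : ∀ x u → x - u - + 1 ≡ x - (+ 1 + u)
  rearrange = solve-∀

-- Summation by parts against Pascal's rule; the boundary term vanishes since n C (n+1) = 0.
alternating-binomial-telescope : ∀ n (g : ℕ → ℤ) →
  sumTo n (λ j → sgn j * + (n C j) * (g j - g (suc j)))
    ≡ sumTo (suc n) (λ j → sgn j * + (suc n C j) * g j)
alternating-binomial-telescope n g = begin
  sumTo n (λ j → sgn j * + (n C j) * (g j - g (suc j)))
    ≡⟨ sumTo-cong n (λ j _ → split (sgn j) (+ (n C j)) (g j) (g (suc j))) ⟩
  sumTo n (λ j → h j + h′ j)
    ≡⟨ sumTo-distrib-+ n h h′ ⟩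
  sumTo n h + sumTo n h′
    ≡⟨ cong (_+ sumTo n h′) h-shifted ⟩
  h 0 + sumTo n (h ∘ suc) + sumTo n h′
    ≡⟨ reassoc (h 0) (sumTo n (h ∘ suc)) (sumTo n h′) ⟩
  h 0 + (sumTo n h′ + sumTo n (h ∘ suc))
    ≡⟨ cong (λ z → h 0 + z) (sumTo-distrib-+ n h′ (h ∘ suc)) ⟨
  h 0 + sumTo n (λ j → h′ j + h (suc j))
    ≡⟨ cong (λ z → h 0 + z) (sumTo-cong n (λ j _ → merge j)) ⟩
  h 0 + sumTo n (λ j → sgn (suc j) * + (suc n C suc j) * g (suc j))
    ≡⟨ sumTo-head n (λ j → sgn j * + (suc n C j) * g j) ⟨
  sumTo (suc n) (λ j → sgn j * + (suc n C j) * g j) ∎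
  where
  open ≡-Reasoning
  h h′ : ℕ → ℤ
  h  j = sgn j * + (n C j) * g j
  h′ j = - (sgn j * + (n C j) * g (suc j))
  split : ∀ s c a b → s * c * (a - b) ≡ s * c * a + - (s * c * b)
  split = solve-∀
  reassoc : ∀ a b c → a + b + c ≡ a + (c + b)
  reassoc = solve-∀
  h-last : h (suc n) ≡ + 0
  h-last rewrite k>n⇒nCk≡0 {n} {suc n} ℕ.≤-refl =
    trans (cong (_* g (suc n)) (ℤ.*-zeroʳ (sgn (suc n)))) (ℤ.*-zeroˡ (g (suc n)))
  h-shifted : sumTo n h ≡ h 0 + sumTo n (h ∘ suc)
  h-shifted = begin
    sumTo n h             ≡⟨ ℤ.+-identityʳ (sumTo n h) ⟨
    sumTo n h + + 0       ≡⟨ cong (λ z → sumTo n h + z) h-last ⟨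
    sumTo (suc n) h       ≡⟨ sumTo-head n h ⟩
    h 0 + sumTo n (h ∘ suc) ∎
  collect : ∀ s a b x → - (s * a * x) + - s * b * x ≡ - s * (a + b) * x
  collect = solve-∀
  merge : ∀ j → h′ j + h (suc j) ≡ sgn (suc j) * + (suc n C suc j) * g (suc j)
  merge j = begin
    h′ j + h (suc j)
      ≡⟨ collect (sgn j) (+ (n C j)) (+ (n C suc j)) (g (suc j)) ⟩
    - sgn j * (+ (n C j) + + (n C suc j)) * g (suc j)
      ≡⟨ cong (λ z → - sgn j * z * g (suc j)) (ℤ.pos-+ (n C j) (n C suc j)) ⟨
    - sgn j * + (n C j ℕ.+ n C suc j) * g (suc j)
      ≡⟨ cong (λ z → - sgn j * + z * g (suc j)) (nCk+nC[k+1]≡[n+1]C[k+1] n j) ⟩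
    sgn (suc j) * + (suc n C suc j) * g (suc j) ∎

module BoundedCompositions (t : ℕ) where

  -- compositions k m counts (k+1)-tuples in {0,…,t} with sum m (inclusion–exclusion over
  -- the parts exceeding t), i.e. the coefficient of x^m in (1 + x + … + x^t)^(k+1).
  compositions : ℕ → ℤ → ℤ
  compositions k m =
    sumTo (suc k) (λ j → sgn j * + (suc k C j) * weakCompositions k (m - + suc t * + j))

  compositions-suc : ∀ k m → compositions (suc k) m ≡ sumTo t (λ i → compositions k (m - + i))
  compositions-suc k m = sym (begin
    sumTo t (λ i → sumTo (suc k) (λ j → c j * W k (m - + i - T * + j)))
      ≡⟨ sumTo-comm t (suc k) (λ i j → c j * W k (m - + i - T * + j)) ⟩
    sumTo (suc k) (λ j → sumTo t (λ i → c j * W k (m - + i - T * + j)))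
      ≡⟨ sumTo-cong (suc k) (λ j _ → window j) ⟩
    sumTo (suc k) (λ j → c j * (g j - g (suc j)))
      ≡⟨ alternating-binomial-telescope (suc k) g ⟩
    compositions (suc k) m ∎)
    where
    open ≡-Reasoning
    W = weakCompositions
    T = + suc t
    c g : ℕ → ℤ
    c j = sgn j * + (suc k C j)
    g j = W (suc k) (m - T * + j)
    swap : ∀ m i x → m - i - x ≡ m - x - i
    swap = solve-∀
    step : ∀ m T j → m - T * j - T ≡ m - T * (+ 1 + j)
    step = solve-∀
    window : ∀ j → sumTo t (λ i → c j * W k (m - + i - T * + j)) ≡ c j * (g j - g (suc j))
    window j = begin
      sumTo t (λ i → c j * W k (m - + i - T * + j))
        ≡⟨ sumTo-cong t (λ i _ → cong (λ z → c j * W k z) (swap m (+ i) (T * + j))) ⟩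
      sumTo t (λ i → c j * W k (m - T * + j - + i))
        ≡⟨ *-distribˡ-sumTo t (c j) (λ i → W k (m - T * + j - + i)) ⟩
      c j * sumTo t (λ i → W k (m - T * + j - + i))
        ≡⟨ cong (c j *_) (weakCompositions-hockeyStick k t (m - T * + j)) ⟩
      c j * (g j - W (suc k) (m - T * + j - T))
        ≡⟨ cong (λ z → c j * (g j - W (suc k) z)) (step m T (+ j)) ⟩
      c j * (g j - g (suc j)) ∎

  compositions-zero : ∀ m → compositions 0 m ≡ binom m (+ 0) - binom (m - + suc t) (+ 0)
  compositions-zero m = trans
    (cong₂ (λ u v → + 1 * + 1 * binom u (+ 0) + - + 1 * + 1 * binom v (+ 0))
           (no-shift m (+ suc t)) (one-shift m (+ suc t)))
    (simplify (binom m (+ 0)) (binom (m - + suc t) (+ 0)))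
    where
    simplify : ∀ a b → + 1 * + 1 * a + - + 1 * + 1 * b ≡ a - b
    simplify = solve-∀
    no-shift : ∀ m T → m - T * + 0 + + 0 ≡ m
    no-shift = solve-∀
    one-shift : ∀ m T → m - T * + 1 + + 0 ≡ m - T
    one-shift = solve-∀

  compositions-zero-reflect : ∀ m → compositions 0 m ≡ compositions 0 (+ t - m)
  compositions-zero-reflect m = begin
    compositions 0 m                          ≡⟨ compositions-zero m ⟩
    I m - I (m - T)                           ≡⟨ rearrange (I m) (I (m - T)) ⟩
    (+ 1 - I (m - T)) - (+ 1 - I m)           ≡⟨ cong₂ _-_ upper lower ⟩
    I (+ t - m) - I (+ t - m - T)             ≡⟨ compositions-zero (+ t - m) ⟨
    compositions 0 (+ t - m)                  ∎
    where
    open ≡-Reasoning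
    I : ℤ → ℤ
    I x = binom x (+ 0)
    T = + suc t
    rearrange : ∀ a b → a - b ≡ (+ 1 - b) - (+ 1 - a)
    rearrange = solve-∀
    solve-for : ∀ a b → a + b ≡ + 1 → + 1 - a ≡ b
    solve-for a b a+b≡1 = trans (cong (_- a) (sym a+b≡1)) (cancel a b)
      where
      cancel : ∀ a b → a + b - a ≡ b
      cancel = solve-∀
    mirror₁ : ∀ m t → - (m - (+ 1 + t)) - + 1 ≡ t - m
    mirror₁ = solve-∀
    mirror₂ : ∀ m t → - m - + 1 ≡ t - m - (+ 1 + t)
    mirror₂ = solve-∀
    upper : + 1 - I (m - T) ≡ I (+ t - m)
    upper = solve-for (I (m - T)) (I (+ t - m))
      (trans (cong (λ z → I (m - T) + I z) (sym (mirror₁ m (+ t)))) (binom-0-complement (m - T)))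
    lower : + 1 - I m ≡ I (+ t - m - T)
    lower = solve-for (I m) (I (+ t - m - T))
      (trans (cong (λ z → I m + I z) (sym (mirror₂ m (+ t)))) (binom-0-complement m))

  compositions-reflect : ∀ k m → compositions k m ≡ compositions k (+ (t ℕ.* suc k) - m)
  compositions-reflect zero m =
    trans (compositions-zero-reflect m) (cong (λ s → compositions 0 (+ s - m)) (sym (ℕ.*-identityʳ t)))
  compositions-reflect (suc k) m = begin
    compositions (suc k) m
      ≡⟨ compositions-suc k m ⟩
    sumTo t f
      ≡⟨ sumTo-reverse t f ⟩
    sumTo t (λ i → f (t ∸ i))
      ≡⟨ sumTo-cong t (λ i i≤t → reflected-term i≤t) ⟩
    sumTo t (λ i → compositions k (P′ - m - + i))
      ≡⟨ compositions-suc k (P′ - m) ⟨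
    compositions (suc k) (P′ - m) ∎
    where
    open ≡-Reasoning
    f : ℕ → ℤ
    f i = compositions k (m - + i)
    P P′ : ℤ
    P  = + (t ℕ.* suc k)
    P′ = + (t ℕ.* suc (suc k))
    P′≡t+P : P′ ≡ + t + P
    P′≡t+P = trans (cong +_ (ℕ.*-suc t (suc k))) (ℤ.pos-+ t (t ℕ.* suc k))
    mirror : ∀ m t i P → P - (m - (t - i)) ≡ t + P - m - i
    mirror = solve-∀
    reflected-term : ∀ {i} → i ≤ t → f (t ∸ i) ≡ compositions k (P′ - m - + i)
    reflected-term {i} i≤t = begin
      compositions k (m - + (t ∸ i))        ≡⟨ cong (λ z → compositions k (m - z)) (pos-∸ i≤t) ⟩
      compositions k (m - (+ t - + i))      ≡⟨ compositions-reflect k (m - (+ t - + i)) ⟩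
      compositions k (P - (m - (+ t - + i)))  ≡⟨ cong (compositions k) (mirror m (+ t) (+ i) P) ⟩
      compositions k (+ t + P - m - + i)    ≡⟨ cong (λ z → compositions k (z - m - + i)) P′≡t+P ⟨
      compositions k (P′ - m - + i)         ∎

open BoundedCompositions

F≡compositions : ∀ t a b c k → a ℕ.+ b ≡ suc k →
  F a b c t ≡ compositions t k (+ (t ℕ.* b) + c)
F≡compositions t a b c k a+b≡1+k rewrite a+b≡1+k =
  sumTo-cong (suc k) λ j _ →
    cong₂ (λ u v → sgn j * u * v) (binom-pos (suc k) j) (cong₂ binom (argument j) (pred-k (+ k)))
  where
  pred-k : ∀ k → + 1 + k - + 1 ≡ k
  pred-k = solve-∀
  a≡1+k-b : + a ≡ + 1 + + k - + b
  a≡1+k-b = trans (add-sub (+ a) (+ b)) (cong (_- + b) (trans (sym (ℤ.pos-+ a b)) (cong +_ a+b≡1+k)))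
    where
    add-sub : ∀ a b → a ≡ a + b - b
    add-sub = solve-∀
  normalise : ∀ t b j c k →
    (+ 1 + t) * (b - j) + (+ 1 + k - b) + c - + 1 ≡ t * b + c - (+ 1 + t) * j + k
  normalise = solve-∀
  argument : ∀ j → + suc t * (+ b - + j) + + a + c - + 1 ≡ + (t ℕ.* b) + c - + suc t * + j + + k
  argument j = begin
    + suc t * (+ b - + j) + + a + c - + 1
      ≡⟨ cong (λ z → + suc t * (+ b - + j) + z + c - + 1) a≡1+k-b ⟩
    + suc t * (+ b - + j) + (+ 1 + + k - + b) + c - + 1
      ≡⟨ normalise (+ t) (+ b) (+ j) c (+ k) ⟩
    + t * + b + c - + suc t * + j + + k
      ≡⟨ cong (λ z → z + c - + suc t * + j + + k) (ℤ.pos-* t b) ⟨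
    + (t ℕ.* b) + c - + suc t * + j + + k ∎
    where open ≡-Reasoning

F-1-1 : ∀ t j → j ≤ t → F 1 1 (+ j) t ≡ + suc t - + j
F-1-1 t j j≤t = begin
  term 0 + term 1 + term 2
    ≡⟨ cong₂ _+_ (cong₂ _+_ term₀ term₁) term₂ ⟩
  + (suc t ℕ.+ j) + - + 1 * + 2 * + j + + 0
    ≡⟨ cong (λ z → z + - + 1 * + 2 * + j + + 0) (ℤ.pos-+ (suc t) j) ⟩
  + suc t + + j + - + 1 * + 2 * + j + + 0
    ≡⟨ simplify (+ suc t) (+ j) ⟩
  + suc t - + j ∎
  where
  open ≡-Reasoning
  term : ℕ → ℤ
  term i = sgn i * binom (+ 2) (+ i) * binom (+ suc t * (+ 1 - + i) + + 1 + + j - + 1) (+ 2 - + 1)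
  simplify : ∀ a b → a + b + - + 1 * + 2 * b + + 0 ≡ a - b
  simplify = solve-∀
  arg₀ : ∀ T j → T * (+ 1 - + 0) + + 1 + j - + 1 ≡ T + j
  arg₀ = solve-∀
  arg₁ : ∀ T j → T * (+ 1 - + 1) + + 1 + j - + 1 ≡ j
  arg₁ = solve-∀
  arg₂ : ∀ t j → (+ 1 + t) * (+ 1 - + 2) + + 1 + j - + 1 ≡ - (t - j) - + 1
  arg₂ = solve-∀
  binom-1 : ∀ n → binom (+ n) (+ 1) ≡ + n
  binom-1 n = trans (binom-pos n 1) (cong +_ (nC1≡n n))
  term₀ : term 0 ≡ + (suc t ℕ.+ j)
  term₀ = trans
    (cong (λ z → + 1 * + 1 * binom z (+ 1)) (trans (arg₀ (+ suc t) (+ j)) (sym (ℤ.pos-+ (suc t) j))))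
    (trans (cong (+ 1 * + 1 *_) (binom-1 (suc t ℕ.+ j))) (ℤ.*-identityˡ _))
  term₁ : term 1 ≡ - + 1 * + 2 * + j
  term₁ = cong (- + 1 * + 2 *_) (trans (cong (λ z → binom z (+ 1)) (arg₁ (+ suc t) (+ j))) (binom-1 j))
  negative : ∀ n → - (+ n) - + 1 ≡ -[1+ n ]
  negative zero    = refl
  negative (suc n) = cong (λ z → -[1+ suc z ]) (ℕ.+-identityʳ n)
  term₂ : term 2 ≡ + 0
  term₂ = cong (λ z → + 1 * + 1 * binom z (+ 1))
    (trans (arg₂ (+ t) (+ j))
      (trans (cong (λ z → - z - + 1) (sym (pos-∸ j≤t))) (negative (t ∸ j))))

iPoly-1-1 : ∀ r s t → iPoly 1 1 r (suc s) t ≡ sumTo t (λ j → (+ suc t - + j) * F r (suc s) (- + j) t)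
iPoly-1-1 r s t =
  trans (cong (λ n → sumTo n (λ j → F 1 1 (+ j) t * F r (suc s) (- + j) t)) (ℕ.*-identityʳ t))
        (sumTo-cong t (λ j j≤t → cong (_* F r (suc s) (- + j) t) (F-1-1 t j j≤t)))

module CorollaryTerms (a b t : ℕ) where

  c : ℕ → ℤ
  c i = compositions t (a ℕ.+ b) (+ (t ℕ.* b) + + i)

  t[1+b]-j : ∀ {j} → j ≤ t → + (t ℕ.* suc b) - + j ≡ + (t ℕ.* b) + + (t ∸ j)
  t[1+b]-j {j} j≤t = begin
    + (t ℕ.* suc b) - + j               ≡⟨ cong (λ n → + n - + j) (ℕ.*-suc t b) ⟩
    + (t ℕ.+ t ℕ.* b) - + j             ≡⟨ cong (_- + j) (ℤ.pos-+ t (t ℕ.* b)) ⟩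
    + t + + (t ℕ.* b) - + j             ≡⟨ rearrange (+ t) (+ (t ℕ.* b)) (+ j) ⟩
    + (t ℕ.* b) + (+ t - + j)           ≡⟨ cong (λ z → + (t ℕ.* b) + z) (pos-∸ j≤t) ⟨
    + (t ℕ.* b) + + (t ∸ j)             ∎
    where
    open ≡-Reasoning
    rearrange : ∀ t X j → t + X - j ≡ X + (t - j)
    rearrange = solve-∀

  F-left : ∀ {j} → j ≤ t → F a (suc b) (- + j) t ≡ c (t ∸ j)
  F-left j≤t =
    trans (F≡compositions t a (suc b) (- + _) (a ℕ.+ b) (ℕ.+-suc a b))
          (cong (compositions t (a ℕ.+ b)) (t[1+b]-j j≤t))

  F-right : ∀ j → F b (suc a) (- + j) t ≡ c j
  F-right j = begin
    F b (suc a) (- + j) t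
      ≡⟨ F≡compositions t b (suc a) (- + j) k (trans (ℕ.+-suc b a) (cong suc (ℕ.+-comm b a))) ⟩
    compositions t k (A + - + j)
      ≡⟨ compositions-reflect t k (A + - + j) ⟩
    compositions t k (+ (t ℕ.* suc k) - (A + - + j))
      ≡⟨ cong (λ z → compositions t k (z - (A + - + j))) t[1+k]≡A+B ⟩
    compositions t k (A + B - (A + - + j))
      ≡⟨ cong (compositions t k) (cancel A B (+ j)) ⟩
    c j ∎
    where
    open ≡-Reasoning
    k = a ℕ.+ b
    A = + (t ℕ.* suc a)
    B = + (t ℕ.* b)
    t[1+k]≡A+B : + (t ℕ.* suc k) ≡ A + B
    t[1+k]≡A+B = trans (cong +_ (ℕ.*-distribˡ-+ t (suc a) b)) (ℤ.pos-+ (t ℕ.* suc a) (t ℕ.* b))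
    cancel : ∀ X Y j → X + Y - (X + - j) ≡ Y + j
    cancel = solve-∀

  F-total : F (suc a) (suc b) (+ 0) t ≡ sumTo t c
  F-total = begin
    F (suc a) (suc b) (+ 0) t
      ≡⟨ F≡compositions t (suc a) (suc b) (+ 0) (suc k) (cong suc (ℕ.+-suc a b)) ⟩
    compositions t (suc k) (+ (t ℕ.* suc b) + + 0)
      ≡⟨ compositions-suc t k (+ (t ℕ.* suc b) + + 0) ⟩
    sumTo t (λ i → compositions t k (+ (t ℕ.* suc b) + + 0 - + i))
      ≡⟨ sumTo-cong t (λ i i≤t → cong (compositions t k)
           (trans (cong (_- + i) (ℤ.+-identityʳ (+ (t ℕ.* suc b)))) (t[1+b]-j i≤t))) ⟩
    sumTo t (λ i → c (t ∸ i))
      ≡⟨ sumTo-reverse t c ⟨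
    sumTo t c ∎
    where
    open ≡-Reasoning
    k = a ℕ.+ b

corollary4p3 : (a b : ℕ) → b ≥ 1 → (t : ℕ) → t ≥ 1 →
    iPoly 1 1 a b t + iPoly 1 1 (b ∸ 1) (suc a) t ≡ (+ (t Data.Nat.+ 2)) * F (suc a) b (+ 0) t
corollary4p3 a (suc b) _ t _ = begin
  iPoly 1 1 a (suc b) t + iPoly 1 1 b (suc a) t
    ≡⟨ cong₂ _+_ (iPoly-1-1 a b t) (iPoly-1-1 b a t) ⟩
  sumTo t (λ j → w j * F a (suc b) (- + j) t) + sumTo t (λ j → w j * F b (suc a) (- + j) t)
    ≡⟨ cong₂ _+_ (sumTo-cong t (λ j j≤t → cong (w j *_) (F-left j≤t)))
                 (sumTo-cong t (λ j _ → cong (w j *_) (F-right j))) ⟩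
  sumTo t (λ j → w j * c (t ∸ j)) + sumTo t (λ j → w j * c j)
    ≡⟨ sumTo-reflected-weights t c ⟩
  + (t ℕ.+ 2) * sumTo t c
    ≡⟨ cong (+ (t ℕ.+ 2) *_) F-total ⟨
  + (t ℕ.+ 2) * F (suc a) (suc b) (+ 0) t ∎
  where
  open ≡-Reasoning
  open CorollaryTerms a b t
  w : ℕ → ℤ
  w j = + suc t - + j
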